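{- Let $A_0,\dots,A_n$ be subalgebras of a Boolean algebra $B$ such that $(A_i)_{i<n+1}$ commutes in $B$ and $(A_i\cap A_n)_{i<n}$ commutes in $B$. Then $(A_i)_{i<n}$ commutes in $B$.
   Context: Given subalgebras $C_0,\dots,C_{k-1}$ of $B$, let $P$ be the quotient of the free product $\bigoplus_{i<k}C_i$ (cofactor maps $\iota_i$) by the ideal generated by all $\iota_i(z)\wedge\iota_j(-z)$ with $z\in C_i\cap C_j$; $(C_i)_{i<k}$ commutes in $B$ if the unique homomorphism $P\to B$ extending the inclusions $C_i\to B$ is injective. -}

module Defs where

open import Level using (Level; _⊔_)
open import Data.Nat using (ℕ; suc)
open import Data.Fin using (Fin; inject₁; fromℕ)
open import Data.Product using (Σ; _×_; _,_; proj₁; proj₂)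
open import Algebra.Lattice.Bundles using (BooleanAlgebra)

record Subalgebra {c ℓ : Level} (p : Level) (B : BooleanAlgebra c ℓ)
         : Set (c ⊔ ℓ ⊔ Level.suc p) where
  open BooleanAlgebra B
  field
    member  : Carrier → Set p
    resp    : ∀ {x y} → x ≈ y → member x → member y
    ⊤-mem   : member ⊤
    ⊥-mem   : member ⊥
    ∧-mem   : ∀ {x y} → member x → member y → member (x ∧ y)
    ∨-mem   : ∀ {x y} → member x → member y → member (x ∨ y)
    ¬-mem   : ∀ {x} → member x → member (¬ x)

open Subalgebra public

_∩_ : ∀ {c ℓ p} {B : BooleanAlgebra c ℓ} → Subalgebra p B → Subalgebra p B → Subalgebra p B
C ∩ D = record
  { member = λ x → member C x × member D x
  ; resp   = λ e m → resp C e (proj₁ m) , resp D e (proj₂ m)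
  ; ⊤-mem  = ⊤-mem C , ⊤-mem D
  ; ⊥-mem  = ⊥-mem C , ⊥-mem D
  ; ∧-mem  = λ m n → ∧-mem C (proj₁ m) (proj₁ n) , ∧-mem D (proj₂ m) (proj₂ n)
  ; ∨-mem  = λ m n → ∨-mem C (proj₁ m) (proj₁ n) , ∨-mem D (proj₂ m) (proj₂ n)
  ; ¬-mem  = λ m → ¬-mem C (proj₁ m) , ¬-mem D (proj₂ m)
  }

module _ {c ℓ p : Level} (B : BooleanAlgebra c ℓ) {k : ℕ} (C : Fin k → Subalgebra p B) where
  open BooleanAlgebra B

  Gen : Set (c ⊔ p)
  Gen = Σ (Fin k) λ i → Σ Carrier (member (C i))

  data Term : Set (c ⊔ p) where
    gen  : Gen → Term
    _∧ₜ_ : Term → Term → Term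
    _∨ₜ_ : Term → Term → Term
    ¬ₜ_  : Term → Term
    ⊤ₜ   : Term
    ⊥ₜ   : Term

  ι : (i : Fin k) (a : Carrier) → member (C i) a → Term
  ι i a m = gen (i , a , m)

  -- Equality of the free product ⊕_{i<k} C_i: the congruence on terms
  -- generated by the Boolean algebra axioms (bounded complemented
  -- distributive lattice) and the equations making each ι_i a Boolean
  -- homomorphism (well defined w.r.t. the equality of B).
  data _≈F_ : Term → Term → Set (c ⊔ ℓ ⊔ p) where
    reflF  : ∀ {t} → t ≈F t
    symF   : ∀ {t s} → t ≈F s → s ≈F t
    transF : ∀ {t s u} → t ≈F s → s ≈F u → t ≈F u
    ∧-congF : ∀ {t t' s s'} → t ≈F t' → s ≈F s' → (t ∧ₜ s) ≈F (t' ∧ₜ s')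
    ∨-congF : ∀ {t t' s s'} → t ≈F t' → s ≈F s' → (t ∨ₜ s) ≈F (t' ∨ₜ s')
    ¬-congF : ∀ {t t'} → t ≈F t' → (¬ₜ t) ≈F (¬ₜ t')
    ∧-commF  : ∀ t s → (t ∧ₜ s) ≈F (s ∧ₜ t)
    ∨-commF  : ∀ t s → (t ∨ₜ s) ≈F (s ∨ₜ t)
    ∧-assocF : ∀ t s u → ((t ∧ₜ s) ∧ₜ u) ≈F (t ∧ₜ (s ∧ₜ u))
    ∨-assocF : ∀ t s u → ((t ∨ₜ s) ∨ₜ u) ≈F (t ∨ₜ (s ∨ₜ u))
    ∧-absF   : ∀ t s → (t ∧ₜ (t ∨ₜ s)) ≈F t
    ∨-absF   : ∀ t s → (t ∨ₜ (t ∧ₜ s)) ≈F t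
    ∧-distF  : ∀ t s u → (t ∧ₜ (s ∨ₜ u)) ≈F ((t ∧ₜ s) ∨ₜ (t ∧ₜ u))
    ∨-distF  : ∀ t s u → (t ∨ₜ (s ∧ₜ u)) ≈F ((t ∨ₜ s) ∧ₜ (t ∨ₜ u))
    ∧-complF : ∀ t → (t ∧ₜ (¬ₜ t)) ≈F ⊥ₜ
    ∨-complF : ∀ t → (t ∨ₜ (¬ₜ t)) ≈F ⊤ₜ
    ι-cong   : ∀ i {a b} (ma : member (C i) a) (mb : member (C i) b) → a ≈ b →
               ι i a ma ≈F ι i b mb
    ι-∧      : ∀ i {a b} (ma : member (C i) a) (mb : member (C i) b) →
               ι i (a ∧ b) (∧-mem (C i) ma mb) ≈F (ι i a ma ∧ₜ ι i b mb)
    ι-∨      : ∀ i {a b} (ma : member (C i) a) (mb : member (C i) b) →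
               ι i (a ∨ b) (∨-mem (C i) ma mb) ≈F (ι i a ma ∨ₜ ι i b mb)
    ι-¬      : ∀ i {a} (ma : member (C i) a) →
               ι i (¬ a) (¬-mem (C i) ma) ≈F (¬ₜ ι i a ma)
    ι-⊤      : ∀ i → ι i ⊤ (⊤-mem (C i)) ≈F ⊤ₜ
    ι-⊥      : ∀ i → ι i ⊥ (⊥-mem (C i)) ≈F ⊥ₜ

  _≤F_ : Term → Term → Set (c ⊔ ℓ ⊔ p)
  t ≤F s = (t ∧ₜ s) ≈F t

  data InIdeal : Term → Set (c ⊔ ℓ ⊔ p) where
    gen-I  : ∀ i j {z} (mi : member (C i) z) (mj : member (C j) z) →
             InIdeal (ι i z mi ∧ₜ ι j (¬ z) (¬-mem (C j) mj))
    ⊥-I    : InIdeal ⊥ₜ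
    ∨-I    : ∀ {t s} → InIdeal t → InIdeal s → InIdeal (t ∨ₜ s)
    down-I : ∀ {t s} → t ≤F s → InIdeal s → InIdeal t

  -- Equality in the quotient P = (⊕_{i<k} C_i) / I:
  -- t ~ s iff their symmetric difference lies in I.
  _≈P_ : Term → Term → Set (c ⊔ ℓ ⊔ p)
  t ≈P s = InIdeal ((t ∧ₜ (¬ₜ s)) ∨ₜ ((¬ₜ t) ∧ₜ s))

  eval : Term → Carrier
  eval (gen (i , a , m)) = a
  eval (t ∧ₜ s) = eval t ∧ eval s
  eval (t ∨ₜ s) = eval t ∨ eval s
  eval (¬ₜ t)   = ¬ eval t
  eval ⊤ₜ       = ⊤
  eval ⊥ₜ       = ⊥

  -- (C_i)_{i<k} commutes in B: the map P → B is injective.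
  Commutes : Set (c ⊔ ℓ ⊔ p)
  Commutes = ∀ t s → eval t ≈ eval s → t ≈P s

-- Let t, s be terms over A₀ … Aₙ₋₁ with the same value in B. Since (Aᵢ)ᵢ≤ₙ commutes, the symmetric
-- difference of t and s lies in the ideal of the big free product, and its derivation mentions
-- finitely many elements of Aₙ and finitely many z ∈ Aᵢ ∩ Aₙ through generators ιᵢ z ∧ ιₙ ¬z.
-- Fix an atom α of B cut out by the former, and an atom of the free product of the Aᵢ ∩ Aₙ cut out
-- by the latter, with images m in the free product of the Aᵢ (i < n) and γ in B. Replacing each
-- ιₙ a by ⊤ or ⊥ according as α ≤ a or α ≤ ¬ a turns the derivation into one placing
-- (t ⊕ s) ∧ m in the ideal of the small free product, unless γ ∧ α = ⊥. Joining over α gives this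
-- unless γ = ⊥, and then m itself is in the ideal because (Aᵢ ∩ Aₙ)ᵢ<ₙ commutes. Joining over the
-- atoms m puts t ⊕ s in the ideal.

module Submission where

open import Level using (Level; _⊔_)
open import Data.Nat using (ℕ; suc)
open import Data.Fin using (Fin; inject₁; fromℕ)
open import Data.Fin.Relation.Unary.Top using (View; view; ‵fromℕ; ‵inj₁; ‵inject₁; view-inject₁)
open import Data.Bool using (Bool; true; false; not) renaming (_∧_ to _∧ᵇ_; _∨_ to _∨ᵇ_)
open import Data.Product using (Σ; _×_; _,_; proj₁)
open import Data.Sum using (_⊎_; inj₁; inj₂; [_,_]′; swap)
open import Data.List using (List; []; _∷_; _++_)
open import Data.List.Membership.Propositional using (_∈_)
open import Data.List.Relation.Unary.Any using (here; there)
open import Data.List.Relation.Unary.All using (All; []; _∷_; lookup; tabulate)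
open import Data.List.Relation.Unary.All.Properties using (++⁺; ++⁻ˡ; ++⁻ʳ)
open import Relation.Binary.PropositionalEquality using (_≡_; refl; cong; cong₂; subst; subst₂; module ≡-Reasoning)
  renaming (sym to sym≡)
open import Function using (id)
open import Algebra.Lattice.Bundles using (BooleanAlgebra)
import Algebra.Lattice.Properties.BooleanAlgebra as BooleanAlgebraProperties
open import Defs

module BooleanAlgebraLemmas {b₁ b₂} (X : BooleanAlgebra b₁ b₂) where
  open BooleanAlgebra X renaming (refl to ≈-refl)
  open BooleanAlgebraProperties X
  open DefaultXorRing
  open import Relation.Binary.Reasoning.Setoid setoid

  infix 4 _≤_
  _≤_ : Carrier → Carrier → Set b₂
  x ≤ y = x ∧ y ≈ x

  ≤-reflexive : ∀ {x y} → x ≈ y → x ≤ y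
  ≤-reflexive {x} x≈y = trans (∧-congˡ (sym x≈y)) (∧-idem x)

  ≤-trans : ∀ {x y z} → x ≤ y → y ≤ z → x ≤ z
  ≤-trans {x} {y} {z} x≤y y≤z = begin
    x ∧ z        ≈⟨ ∧-congʳ x≤y ⟨
    (x ∧ y) ∧ z  ≈⟨ ∧-assoc x y z ⟩
    x ∧ (y ∧ z)  ≈⟨ ∧-congˡ y≤z ⟩
    x ∧ y        ≈⟨ x≤y ⟩
    x            ∎

  ≤-respʳ-≈ : ∀ {x y z} → y ≈ z → x ≤ y → x ≤ z
  ≤-respʳ-≈ y≈z x≤y = trans (∧-congˡ (sym y≈z)) x≤y

  x∧y≤x : ∀ x y → x ∧ y ≤ x
  x∧y≤x x y = begin
    (x ∧ y) ∧ x  ≈⟨ ∧-comm (x ∧ y) x ⟩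
    x ∧ (x ∧ y)  ≈⟨ ∧-assoc x x y ⟨
    (x ∧ x) ∧ y  ≈⟨ ∧-congʳ (∧-idem x) ⟩
    x ∧ y        ∎

  x∧y≤y : ∀ x y → x ∧ y ≤ y
  x∧y≤y x y = trans (∧-assoc x y y) (∧-congˡ (∧-idem y))

  x≤x∨y : ∀ x y → x ≤ x ∨ y
  x≤x∨y = ∧-absorbs-∨

  y≤x∨y : ∀ x y → y ≤ x ∨ y
  y≤x∨y x y = ≤-respʳ-≈ (∨-comm y x) (x≤x∨y y x)

  ∧-greatest : ∀ {x y z} → x ≤ y → x ≤ z → x ≤ y ∧ z
  ∧-greatest {x} {y} {z} x≤y x≤z = begin
    x ∧ (y ∧ z)  ≈⟨ ∧-assoc x y z ⟨
    (x ∧ y) ∧ z  ≈⟨ ∧-congʳ x≤y ⟩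
    x ∧ z        ≈⟨ x≤z ⟩
    x            ∎

  ∧-monoˡ-≤ : ∀ {x y} z → x ≤ y → x ∧ z ≤ y ∧ z
  ∧-monoˡ-≤ {x} z x≤y = ∧-greatest (≤-trans (x∧y≤x x z) x≤y) (x∧y≤y x z)

  x≤⊥⇒x≈⊥ : ∀ {x} → x ≤ ⊥ → x ≈ ⊥
  x≤⊥⇒x≈⊥ {x} x≤⊥ = trans (sym x≤⊥) (∧-zeroʳ x)

  ≤-contradiction : ∀ {x a} → x ≤ a → x ≤ ¬ a → x ≈ ⊥
  ≤-contradiction x≤a x≤¬a = x≤⊥⇒x≈⊥ (≤-respʳ-≈ (∧-complementʳ _) (∧-greatest x≤a x≤¬a))

  x≈x∧y∨x∧¬y : ∀ x y → x ≈ (x ∧ y) ∨ (x ∧ ¬ y)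
  x≈x∧y∨x∧¬y x y = begin
    x                    ≈⟨ ∧-identityʳ x ⟨
    x ∧ ⊤                ≈⟨ ∧-congˡ (∨-complementʳ y) ⟨
    x ∧ (y ∨ ¬ y)        ≈⟨ ∧-distribˡ-∨ x y (¬ y) ⟩
    (x ∧ y) ∨ (x ∧ ¬ y)  ∎

  x∧¬⊥∨¬x∧⊥≈x : ∀ x → (x ∧ ¬ ⊥) ∨ (¬ x ∧ ⊥) ≈ x
  x∧¬⊥∨¬x∧⊥≈x x = begin
    (x ∧ ¬ ⊥) ∨ (¬ x ∧ ⊥)  ≈⟨ ∨-cong (∧-congˡ ¬⊥≈⊤) (∧-zeroʳ (¬ x)) ⟩
    (x ∧ ⊤) ∨ ⊥            ≈⟨ ∨-identityʳ (x ∧ ⊤) ⟩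
    x ∧ ⊤                  ≈⟨ ∧-identityʳ x ⟩
    x                      ∎

  literal : Carrier → Bool → Carrier
  literal a true  = a
  literal a false = ¬ a

  literal-cong : ∀ {a b} s → a ≈ b → literal a s ≈ literal b s
  literal-cong true  a≈b = a≈b
  literal-cong false a≈b = ¬-cong a≈b

  literal-unique : ∀ {x a} s t → x ≤ literal a s → x ≤ literal a t → s ≡ t ⊎ x ≈ ⊥
  literal-unique true  true  _ _ = inj₁ refl
  literal-unique false false _ _ = inj₁ refl
  literal-unique true  false p q = inj₂ (≤-contradiction p q)
  literal-unique false true  p q = inj₂ (≤-contradiction q p)

  literal-disjoint : ∀ {x y a} s → x ≤ literal a s → y ≤ literal a (not s) → x ∧ y ≈ ⊥
  literal-disjoint {x} {y} true  p q =
    ≤-contradiction (≤-trans (x∧y≤x x y) p) (≤-trans (x∧y≤y x y) q)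
  literal-disjoint {x} {y} false p q =
    ≤-contradiction (≤-trans (x∧y≤y x y) q) (≤-trans (x∧y≤x x y) p)

  literal-∧ : ∀ {x a b} s t → x ≤ literal a s → x ≤ literal b t → x ≤ literal (a ∧ b) (s ∧ᵇ t)
  literal-∧ true true p q = ∧-greatest p q
  literal-∧ {a = a} {b} true false p q =
    ≤-respʳ-≈ (sym (deMorgan₁ a b)) (≤-trans q (y≤x∨y (¬ a) (¬ b)))
  literal-∧ {a = a} {b} false t p q =
    ≤-respʳ-≈ (sym (deMorgan₁ a b)) (≤-trans p (x≤x∨y (¬ a) (¬ b)))

  literal-∨ : ∀ {x a b} s t → x ≤ literal a s → x ≤ literal b t → x ≤ literal (a ∨ b) (s ∨ᵇ t)
  literal-∨ {a = a} {b} true t p q = ≤-trans p (x≤x∨y a b)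
  literal-∨ {a = a} {b} false true p q = ≤-trans q (y≤x∨y a b)
  literal-∨ {a = a} {b} false false p q = ≤-respʳ-≈ (sym (deMorgan₂ a b)) (∧-greatest p q)

  literal-¬ : ∀ {x a} s → x ≤ literal a s → x ≤ literal (¬ a) (not s)
  literal-¬ true  p = ≤-respʳ-≈ (sym (¬-involutive _)) p
  literal-¬ false p = p

  ⊤-literal : ∀ x → x ≤ literal ⊤ true
  ⊤-literal = ∧-identityʳ

  ⊥-literal : ∀ x → x ≤ literal ⊥ false
  ⊥-literal x = ≤-respʳ-≈ (sym ¬⊥≈⊤) (∧-identityʳ x)

  truth : Bool → Carrier
  truth true  = ⊤
  truth false = ⊥

  truth-∧ : ∀ s t → truth (s ∧ᵇ t) ≈ truth s ∧ truth t
  truth-∧ true  t = sym (∧-identityˡ (truth t))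
  truth-∧ false t = sym (∧-zeroˡ (truth t))

  truth-∨ : ∀ s t → truth (s ∨ᵇ t) ≈ truth s ∨ truth t
  truth-∨ true  t = sym (∨-zeroˡ (truth t))
  truth-∨ false t = sym (∨-identityˡ (truth t))

  truth-not : ∀ s → truth (not s) ≈ ¬ truth s
  truth-not true  = sym ¬⊤≈⊥
  truth-not false = sym ¬⊥≈⊤

  atom : ∀ {a} {I : Set a} {is : List I} → (I → Carrier) → All (λ _ → Bool) is → Carrier
  atom f []                   = ⊤
  atom {is = i ∷ _} f (s ∷ σ) = literal (f i) s ∧ atom f σ

  atom≤literal : ∀ {a} {I : Set a} {is : List I} {i} (f : I → Carrier)
                 (σ : All (λ _ → Bool) is) (q : i ∈ is) → atom f σ ≤ literal (f i) (lookup σ q)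
  atom≤literal f (s ∷ σ) (here refl) = x∧y≤x _ _
  atom≤literal f (s ∷ σ) (there q)   = ≤-trans (x∧y≤y _ _) (atom≤literal f σ q)

  record IsIdeal {k} (K : Carrier → Set k) : Set (b₁ ⊔ b₂ ⊔ k) where
    field
      ⊥∈       : K ⊥
      ∨-closed : ∀ {x y} → K x → K y → K (x ∨ y)
      ≤-closed : ∀ {x y} → x ≤ y → K y → K x

    ≈-closed : ∀ {x y} → x ≈ y → K y → K x
    ≈-closed x≈y = ≤-closed (≤-reflexive x≈y)

    ≈⊥-closed : ∀ {x} → x ≈ ⊥ → K x
    ≈⊥-closed x≈⊥ = ≈-closed x≈⊥ ⊥∈

    ∧-closedˡ : ∀ {x y} → K y → K (x ∧ y)
    ∧-closedˡ = ≤-closed (x∧y≤y _ _)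

    ∧-closedʳ : ∀ {x y} → K x → K (x ∧ y)
    ∧-closedʳ = ≤-closed (x∧y≤x _ _)

    ⊕-closed : ∀ {x y} → K x → K y → K (x ⊕ y)
    ⊕-closed Kx Ky = ≤-closed (x∧y≤x _ _) (∨-closed Kx Ky)

    infix 4 _~_
    _~_ : Carrier → Carrier → Set k
    x ~ y = K (x ⊕ y)

    ~-reflexive : ∀ {x y} → x ≈ y → x ~ y
    ~-reflexive {x} x≈y = ≈⊥-closed (trans (⊕-cong ≈-refl (sym x≈y)) (⊕-inverseʳ x))

    ~-sym : ∀ {x y} → x ~ y → y ~ x
    ~-sym = ≈-closed (⊕-comm _ _)

    ~-trans : ∀ {x y z} → x ~ y → y ~ z → x ~ z
    ~-trans {x} {y} {z} x~y y~z = ≈-closed x⊕z≈ (⊕-closed x~y y~z)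
      where
      x⊕z≈ : x ⊕ z ≈ (x ⊕ y) ⊕ (y ⊕ z)
      x⊕z≈ = begin
        x ⊕ z              ≈⟨ ⊕-cong ≈-refl (⊕-identityˡ z) ⟨
        x ⊕ (⊥ ⊕ z)        ≈⟨ ⊕-cong ≈-refl (⊕-cong (⊕-inverseʳ y) ≈-refl) ⟨
        x ⊕ ((y ⊕ y) ⊕ z)  ≈⟨ ⊕-cong ≈-refl (⊕-assoc y y z) ⟩
        x ⊕ (y ⊕ (y ⊕ z))  ≈⟨ ⊕-assoc x y (y ⊕ z) ⟨
        (x ⊕ y) ⊕ (y ⊕ z)  ∎

    ~-closed : ∀ {x y} → x ~ y → K y → K x
    ~-closed {x} {y} x~y Ky = ≈-closed x≈ (⊕-closed Ky x~y)
      where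
      x≈ : x ≈ y ⊕ (x ⊕ y)
      x≈ = begin
        x            ≈⟨ ⊕-identityˡ x ⟨
        ⊥ ⊕ x        ≈⟨ ⊕-cong (⊕-inverseʳ y) ≈-refl ⟨
        (y ⊕ y) ⊕ x  ≈⟨ ⊕-assoc y y x ⟩
        y ⊕ (y ⊕ x)  ≈⟨ ⊕-cong ≈-refl (⊕-comm y x) ⟩
        y ⊕ (x ⊕ y)  ∎

    ~-∧ : ∀ {x y z w} → x ~ y → z ~ w → x ∧ z ~ y ∧ w
    ~-∧ {x} {y} {z} {w} x~y z~w = ≈-closed split (⊕-closed (∧-closedʳ x~y) (∧-closedˡ z~w))
      where
      split : (x ∧ z) ⊕ (y ∧ w) ≈ ((x ⊕ y) ∧ z) ⊕ (y ∧ (z ⊕ w))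
      split = begin
        (x ∧ z) ⊕ (y ∧ w)                          ≈⟨ ⊕-cong ≈-refl (⊕-identityˡ _) ⟨
        (x ∧ z) ⊕ (⊥ ⊕ (y ∧ w))                    ≈⟨ ⊕-cong ≈-refl (⊕-cong (⊕-inverseʳ (y ∧ z)) ≈-refl) ⟨
        (x ∧ z) ⊕ ((y ∧ z ⊕ y ∧ z) ⊕ (y ∧ w))      ≈⟨ ⊕-cong ≈-refl (⊕-assoc _ _ _) ⟩
        (x ∧ z) ⊕ (y ∧ z ⊕ (y ∧ z ⊕ y ∧ w))        ≈⟨ ⊕-assoc _ _ _ ⟨
        (x ∧ z ⊕ y ∧ z) ⊕ (y ∧ z ⊕ y ∧ w)          ≈⟨ ⊕-cong (∧-distribʳ-⊕ z x y) (∧-distribˡ-⊕ y z w) ⟨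
        ((x ⊕ y) ∧ z) ⊕ (y ∧ (z ⊕ w))              ∎

    ~-¬ : ∀ {x y} → x ~ y → ¬ x ~ ¬ y
    ~-¬ = ≈-closed (sym (⊕-annihilates-¬ _ _))

    ~-∨ : ∀ {x y z w} → x ~ y → z ~ w → x ∨ z ~ y ∨ w
    ~-∨ x~y z~w = ~-trans (~-reflexive (∨-as-∧ _ _))
                          (~-trans (~-¬ (~-∧ (~-¬ x~y) (~-¬ z~w))) (~-reflexive (sym (∨-as-∧ _ _))))
      where
      ∨-as-∧ : ∀ x z → x ∨ z ≈ ¬ (¬ x ∧ ¬ z)
      ∨-as-∧ x z = trans (sym (¬-involutive _)) (¬-cong (deMorgan₂ x z))

  ≈⊥-isIdeal : IsIdeal (_≈ ⊥)
  ≈⊥-isIdeal = record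
    { ⊥∈       = ≈-refl
    ; ∨-closed = λ x≈⊥ y≈⊥ → trans (∨-cong x≈⊥ y≈⊥) (∨-identityʳ ⊥)
    ; ≤-closed = λ x≤y y≈⊥ → x≤⊥⇒x≈⊥ (≤-respʳ-≈ y≈⊥ x≤y)
    }

  const⊎-isIdeal : ∀ {k q} {K : Carrier → Set k} (Q : Set q) → IsIdeal K → IsIdeal (λ x → Q ⊎ K x)
  const⊎-isIdeal Q K-ideal = record
    { ⊥∈       = inj₂ ⊥∈
    ; ∨-closed = λ { (inj₁ q) _ → inj₁ q ; (inj₂ _) (inj₁ q) → inj₁ q
                   ; (inj₂ Kx) (inj₂ Ky) → inj₂ (∨-closed Kx Ky) }
    ; ≤-closed = λ { x≤y (inj₁ q) → inj₁ q ; x≤y (inj₂ Ky) → inj₂ (≤-closed x≤y Ky) }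
    }
    where open IsIdeal K-ideal

  ∧-preimage-isIdeal : ∀ {k} {K : Carrier → Set k} → IsIdeal K → ∀ m → IsIdeal (λ x → K (x ∧ m))
  ∧-preimage-isIdeal K-ideal m = record
    { ⊥∈       = ≈⊥-closed (∧-zeroˡ m)
    ; ∨-closed = λ Kx Ky → ≈-closed (∧-distribʳ-∨ m _ _) (∨-closed Kx Ky)
    ; ≤-closed = λ x≤y → ≤-closed (∧-monoˡ-≤ m x≤y)
    }
    where open IsIdeal K-ideal

  ideal-by-atoms : ∀ {k a} {K : Carrier → Set k} {I : Set a} → IsIdeal K →
                   (f : I → Carrier) (is : List I) {x : Carrier} →
                   (∀ (σ : All (λ _ → Bool) is) → K (x ∧ atom f σ)) → K x
  ideal-by-atoms K-ideal f []       {x} K[x∧atom] = ≈-closed (sym (∧-identityʳ x)) (K[x∧atom] [])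
    where open IsIdeal K-ideal
  ideal-by-atoms {K = K} K-ideal f (i ∷ is) {x} K[x∧atom] =
    ≈-closed (x≈x∧y∨x∧¬y x (f i)) (∨-closed (restrict true) (restrict false))
    where
    open IsIdeal K-ideal
    restrict : ∀ s → K (x ∧ literal (f i) s)
    restrict s = ideal-by-atoms K-ideal f is λ σ → ≈-closed (∧-assoc _ _ _) (K[x∧atom] (s ∷ σ))

module _ {a₁ a₂ b₁ b₂} {X : BooleanAlgebra a₁ a₂} {Y : BooleanAlgebra b₁ b₂} where
  private
    module X = BooleanAlgebra X
    module Y = BooleanAlgebra Y
    module LX = BooleanAlgebraLemmas X
    module LY = BooleanAlgebraLemmas Y

  atom-homomorphic : (φ : X.Carrier → Y.Carrier) →
                     (∀ x y → φ (x X.∧ y) ≡ φ x Y.∧ φ y) → (∀ x → φ (X.¬ x) ≡ Y.¬ φ x) → φ X.⊤ ≡ Y.⊤ →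
                     ∀ {a} {I : Set a} {is : List I} (f : I → X.Carrier) (σ : All (λ _ → Bool) is) →
                     φ (LX.atom f σ) ≡ LY.atom (λ i → φ (f i)) σ
  atom-homomorphic φ φ-∧ φ-¬ φ-⊤ f [] = φ-⊤
  atom-homomorphic φ φ-∧ φ-¬ φ-⊤ {is = i ∷ _} f (s ∷ σ) = begin
    φ (LX.literal (f i) s X.∧ LX.atom f σ)   ≡⟨ φ-∧ _ _ ⟩
    φ (LX.literal (f i) s) Y.∧ φ (LX.atom f σ) ≡⟨ cong₂ Y._∧_ (φ-literal s) (atom-homomorphic φ φ-∧ φ-¬ φ-⊤ f σ) ⟩
    LY.literal (φ (f i)) s Y.∧ LY.atom _ σ    ∎
    where
    open ≡-Reasoning
    φ-literal : ∀ s → φ (LX.literal (f i) s) ≡ LY.literal (φ (f i)) s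
    φ-literal true  = refl
    φ-literal false = φ-¬ (f i)

module _ {c ℓ p} (B : BooleanAlgebra c ℓ) {k} (C : Fin k → Subalgebra p B) where

  freeProduct : BooleanAlgebra (c ⊔ p) (c ⊔ ℓ ⊔ p)
  freeProduct = record
    { Carrier          = Term B C
    ; _≈_              = _≈F_ B C
    ; _∨_              = _∨ₜ_
    ; _∧_              = _∧ₜ_
    ; ¬_               = ¬ₜ_
    ; ⊤                = ⊤ₜ
    ; ⊥                = ⊥ₜ
    ; isBooleanAlgebra = record
      { isDistributiveLattice = record
        { isLattice = record
          { isEquivalence = record { refl = reflF ; sym = symF ; trans = transF }
          ; ∨-comm        = ∨-commF
          ; ∨-assoc       = ∨-assocF
          ; ∨-cong        = ∨-congF
          ; ∧-comm        = ∧-commF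
          ; ∧-assoc       = ∧-assocF
          ; ∧-cong        = ∧-congF
          ; absorptive    = ∨-absF , ∧-absF
          }
        ; ∨-distrib-∧ = ∨-distF , λ t s u →
            transF (∨-commF _ _) (transF (∨-distF t s u) (∧-congF (∨-commF _ _) (∨-commF _ _)))
        ; ∧-distrib-∨ = ∧-distF , λ t s u →
            transF (∧-commF _ _) (transF (∧-distF t s u) (∨-congF (∧-commF _ _) (∧-commF _ _)))
        }
      ; ∨-complement = (λ t → transF (∨-commF _ _) (∨-complF t)) , ∨-complF
      ; ∧-complement = (λ t → transF (∧-commF _ _) (∧-complF t)) , ∧-complF
      ; ¬-cong       = ¬-congF
      }
    }

  InIdeal-isIdeal : BooleanAlgebraLemmas.IsIdeal freeProduct (InIdeal B C)
  InIdeal-isIdeal = record { ⊥∈ = ⊥-I ; ∨-closed = ∨-I ; ≤-closed = down-I }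

module _ {c ℓ p} {B : BooleanAlgebra c ℓ} {k m} {C : Fin k → Subalgebra p B} {D : Fin m → Subalgebra p B}
         (f : Fin k → Fin m) (g : ∀ {i a} → member (C i) a → member (D (f i)) a) where
  open BooleanAlgebra B using () renaming (refl to ≈-refl)

  rename : Term B C → Term B D
  rename (gen (i , a , mem)) = gen (f i , a , g mem)
  rename (t ∧ₜ s)            = rename t ∧ₜ rename s
  rename (t ∨ₜ s)            = rename t ∨ₜ rename s
  rename (¬ₜ t)              = ¬ₜ rename t
  rename ⊤ₜ                  = ⊤ₜ
  rename ⊥ₜ                  = ⊥ₜ

  eval-rename : ∀ t → eval B D (rename t) ≡ eval B C t
  eval-rename (gen _)  = refl
  eval-rename (t ∧ₜ s) = cong₂ (BooleanAlgebra._∧_ B) (eval-rename t) (eval-rename s)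
  eval-rename (t ∨ₜ s) = cong₂ (BooleanAlgebra._∨_ B) (eval-rename t) (eval-rename s)
  eval-rename (¬ₜ t)   = cong (BooleanAlgebra.¬_ B) (eval-rename t)
  eval-rename ⊤ₜ       = refl
  eval-rename ⊥ₜ       = refl

  -- the membership proofs produced by g and by the closure operations of D differ,
  -- so each generator equation is preceded by ι-cong
  rename-cong : ∀ {t s} → _≈F_ B C t s → _≈F_ B D (rename t) (rename s)
  rename-cong reflF              = reflF
  rename-cong (symF e)           = symF (rename-cong e)
  rename-cong (transF e e′)      = transF (rename-cong e) (rename-cong e′)
  rename-cong (∧-congF e e′)     = ∧-congF (rename-cong e) (rename-cong e′)
  rename-cong (∨-congF e e′)     = ∨-congF (rename-cong e) (rename-cong e′)
  rename-cong (¬-congF e)        = ¬-congF (rename-cong e)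
  rename-cong (∧-commF t s)      = ∧-commF _ _
  rename-cong (∨-commF t s)      = ∨-commF _ _
  rename-cong (∧-assocF t s u)   = ∧-assocF _ _ _
  rename-cong (∨-assocF t s u)   = ∨-assocF _ _ _
  rename-cong (∧-absF t s)       = ∧-absF _ _
  rename-cong (∨-absF t s)       = ∨-absF _ _
  rename-cong (∧-distF t s u)    = ∧-distF _ _ _
  rename-cong (∨-distF t s u)    = ∨-distF _ _ _
  rename-cong (∧-complF t)       = ∧-complF _
  rename-cong (∨-complF t)       = ∨-complF _
  rename-cong (ι-cong i ma mb e) = ι-cong (f i) (g ma) (g mb) e
  rename-cong (ι-∧ i ma mb)      = transF (ι-cong (f i) _ _ ≈-refl) (ι-∧ (f i) (g ma) (g mb))
  rename-cong (ι-∨ i ma mb)      = transF (ι-cong (f i) _ _ ≈-refl) (ι-∨ (f i) (g ma) (g mb))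
  rename-cong (ι-¬ i ma)         = transF (ι-cong (f i) _ _ ≈-refl) (ι-¬ (f i) (g ma))
  rename-cong (ι-⊤ i)            = transF (ι-cong (f i) _ _ ≈-refl) (ι-⊤ (f i))
  rename-cong (ι-⊥ i)            = transF (ι-cong (f i) _ _ ≈-refl) (ι-⊥ (f i))

  rename-InIdeal : ∀ {t} → InIdeal B C t → InIdeal B D (rename t)
  rename-InIdeal (gen-I i j mi mj) =
    ≈-closed (∧-congF reflF (ι-cong (f j) _ _ ≈-refl)) (gen-I (f i) (f j) (g mi) (g mj))
    where open BooleanAlgebraLemmas.IsIdeal (InIdeal-isIdeal B D)
  rename-InIdeal ⊥-I          = ⊥-I
  rename-InIdeal (∨-I d d′)   = ∨-I (rename-InIdeal d) (rename-InIdeal d′)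
  rename-InIdeal (down-I e d) = down-I (rename-cong e) (rename-InIdeal d)

module LastCofactor {c ℓ p} (B : BooleanAlgebra c ℓ) (n : ℕ) (A : Fin (suc n) → Subalgebra p B) where
  open BooleanAlgebra B using (Carrier; _≈_; _∧_; ¬_; ⊥; sym; trans; ∧-congˡ)
  open BooleanAlgebraProperties B using (∧-zeroʳ)
  open BooleanAlgebraLemmas B

  A<n : Fin n → Subalgebra p B
  A<n i = A (inject₁ i)

  A∩ : Fin n → Subalgebra p B
  A∩ i = A (inject₁ i) ∩ A (fromℕ n)

  private
    module F = BooleanAlgebraLemmas (freeProduct B A<n)
    module FP = BooleanAlgebraProperties (freeProduct B A<n)

  embed : Term B A<n → Term B A
  embed = rename inject₁ id

  restrict : Term B A∩ → Term B A<n
  restrict = rename id proj₁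

  lastGeneratorsᵍ : {i : Fin (suc n)} → View i → Carrier → List Carrier
  lastGeneratorsᵍ ‵fromℕ   a = a ∷ []
  lastGeneratorsᵍ (‵inj₁ _) a = []

  lastGenerators : Term B A → List Carrier
  lastGenerators (gen (i , a , _)) = lastGeneratorsᵍ (view i) a
  lastGenerators (t ∧ₜ s)          = lastGenerators t ++ lastGenerators s
  lastGenerators (t ∨ₜ s)          = lastGenerators t ++ lastGenerators s
  lastGenerators (¬ₜ t)            = lastGenerators t
  lastGenerators ⊤ₜ                = []
  lastGenerators ⊥ₜ                = []

  -- the generators from A (fromℕ n) of the intermediate terms of the transitivity steps
  lastGenerators≈ : ∀ {t s} → _≈F_ B A t s → List Carrier
  lastGenerators≈ (symF e)              = lastGenerators≈ e
  lastGenerators≈ (transF {s = s} e e′) = lastGenerators s ++ (lastGenerators≈ e ++ lastGenerators≈ e′)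
  lastGenerators≈ (∧-congF e e′)        = lastGenerators≈ e ++ lastGenerators≈ e′
  lastGenerators≈ (∨-congF e e′)        = lastGenerators≈ e ++ lastGenerators≈ e′
  lastGenerators≈ (¬-congF e)           = lastGenerators≈ e
  lastGenerators≈ _                     = []

  lastGeneratorsᴵ : ∀ {t} → InIdeal B A t → List Carrier
  lastGeneratorsᴵ (gen-I _ _ _ _)      = []
  lastGeneratorsᴵ ⊥-I                  = []
  lastGeneratorsᴵ (∨-I d d′)           = lastGeneratorsᴵ d ++ lastGeneratorsᴵ d′
  lastGeneratorsᴵ (down-I {s = s} e d) = lastGenerators s ++ (lastGenerators≈ e ++ lastGeneratorsᴵ d)

  sharedGeneratorsᵍ : {i j : Fin (suc n)} → View i → View j →
                      ∀ {z} → member (A i) z → member (A j) z → List (Gen B A∩)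
  sharedGeneratorsᵍ (‵inject₁ i) (‵inject₁ j) mi mj = []
  sharedGeneratorsᵍ (‵inject₁ i) ‵fromℕ       mi mj = (i , _ , mi , mj) ∷ []
  sharedGeneratorsᵍ ‵fromℕ       (‵inject₁ j) mi mj = (j , _ , mj , mi) ∷ []
  sharedGeneratorsᵍ ‵fromℕ       ‵fromℕ       mi mj = []

  sharedGenerators : ∀ {t} → InIdeal B A t → List (Gen B A∩)
  sharedGenerators (gen-I i j mi mj) = sharedGeneratorsᵍ (view i) (view j) mi mj
  sharedGenerators ⊥-I               = []
  sharedGenerators (∨-I d d′)        = sharedGenerators d ++ sharedGenerators d′
  sharedGenerators (down-I _ d)      = sharedGenerators d

  Decides : Carrier → Carrier → Set ℓ
  Decides α a = Σ Bool λ s → α ≤ literal a s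

  module Substitution (α : Carrier) where

    substᵍ : {i : Fin (suc n)} (w : View i) {a : Carrier} → member (A i) a →
             All (Decides α) (lastGeneratorsᵍ w a) → Term B A<n
    substᵍ ‵fromℕ       _   ((s , _) ∷ []) = F.truth s
    substᵍ (‵inject₁ j) mem []             = gen (j , _ , mem)

    substLast : (t : Term B A) → All (Decides α) (lastGenerators t) → Term B A<n
    substLast (gen (i , _ , mem)) P = substᵍ (view i) mem P
    substLast (t ∧ₜ s)            P = substLast t (++⁻ˡ (lastGenerators t) P) ∧ₜ substLast s (++⁻ʳ (lastGenerators t) P)
    substLast (t ∨ₜ s)            P = substLast t (++⁻ˡ (lastGenerators t) P) ∨ₜ substLast s (++⁻ʳ (lastGenerators t) P)
    substLast (¬ₜ t)              P = ¬ₜ substLast t P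
    substLast ⊤ₜ                  _ = ⊤ₜ
    substLast ⊥ₜ                  _ = ⊥ₜ

    substᵍ-inject₁ : ∀ {j a} (mem : member (A<n j) a) (w : View (inject₁ j)) → w ≡ ‵inj₁ (view j) →
                     ∀ P → substᵍ w mem P ≡ gen (j , a , mem)
    substᵍ-inject₁ mem _ refl [] = refl

    substLast-embed : ∀ t P → substLast (embed t) P ≡ t
    substLast-embed (gen (j , a , mem)) P = substᵍ-inject₁ mem (view (inject₁ j)) (view-inject₁ j) P
    substLast-embed (t ∧ₜ s) _ = cong₂ _∧ₜ_ (substLast-embed t _) (substLast-embed s _)
    substLast-embed (t ∨ₜ s) _ = cong₂ _∨ₜ_ (substLast-embed t _) (substLast-embed s _)
    substLast-embed (¬ₜ t)   P = cong ¬ₜ_ (substLast-embed t P)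
    substLast-embed ⊤ₜ       _ = refl
    substLast-embed ⊥ₜ       _ = refl

  -- The substitution is a homomorphism modulo any ideal that becomes everything when α ≈ ⊥.
  module Soundness {k} (α : Carrier) {K : Term B A<n → Set k} (K-ideal : F.IsIdeal K)
                   (escape : α ≈ ⊥ → ∀ x → K x) where
    open Substitution α
    open F.IsIdeal K-ideal

    truth-forced : ∀ {a} s t → α ≤ literal a s → α ≤ literal a t → F.truth s ~ F.truth t
    truth-forced s t p q with literal-unique s t p q
    ... | inj₁ refl = ~-reflexive reflF
    ... | inj₂ α≈⊥  = escape α≈⊥ _

    substᵍ-irrelevant : ∀ {i} (w : View i) {a} (mem : member (A i) a) P Q → substᵍ w mem P ~ substᵍ w mem Q
    substᵍ-irrelevant ‵fromℕ       _ ((s , p) ∷ []) ((t , q) ∷ []) = truth-forced s t p q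
    substᵍ-irrelevant (‵inject₁ _) _ []             []             = ~-reflexive reflF

    substLast-irrelevant : ∀ t P Q → substLast t P ~ substLast t Q
    substLast-irrelevant (gen (i , _ , mem)) P Q = substᵍ-irrelevant (view i) mem P Q
    substLast-irrelevant (t ∧ₜ s) _ _ = ~-∧ (substLast-irrelevant t _ _) (substLast-irrelevant s _ _)
    substLast-irrelevant (t ∨ₜ s) _ _ = ~-∨ (substLast-irrelevant t _ _) (substLast-irrelevant s _ _)
    substLast-irrelevant (¬ₜ t)   P Q = ~-¬ (substLast-irrelevant t P Q)
    substLast-irrelevant ⊤ₜ       _ _ = ~-reflexive reflF
    substLast-irrelevant ⊥ₜ       _ _ = ~-reflexive reflF

    substᵍ-cong : ∀ {i} (w : View i) {a b} (ma : member (A i) a) (mb : member (A i) b) → a ≈ b →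
                  ∀ P Q → substᵍ w ma P ~ substᵍ w mb Q
    substᵍ-cong ‵fromℕ       _  _  a≈b ((s , p) ∷ []) ((t , q) ∷ []) =
      truth-forced s t p (≤-respʳ-≈ (literal-cong t (sym a≈b)) q)
    substᵍ-cong (‵inject₁ j) ma mb a≈b [] [] = ~-reflexive (ι-cong j ma mb a≈b)

    substᵍ-∧ : ∀ {i} (w : View i) {a b} (ma : member (A i) a) (mb : member (A i) b) → ∀ P Q R →
               substᵍ w (∧-mem (A i) ma mb) P ~ substᵍ w ma Q ∧ₜ substᵍ w mb R
    substᵍ-∧ ‵fromℕ _ _ ((s , p) ∷ []) ((s₁ , p₁) ∷ []) ((s₂ , p₂) ∷ []) =
      ~-trans (truth-forced s (s₁ ∧ᵇ s₂) p (literal-∧ s₁ s₂ p₁ p₂)) (~-reflexive (F.truth-∧ s₁ s₂))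
    substᵍ-∧ (‵inject₁ j) ma mb [] [] [] = ~-reflexive (ι-∧ j ma mb)

    substᵍ-∨ : ∀ {i} (w : View i) {a b} (ma : member (A i) a) (mb : member (A i) b) → ∀ P Q R →
               substᵍ w (∨-mem (A i) ma mb) P ~ substᵍ w ma Q ∨ₜ substᵍ w mb R
    substᵍ-∨ ‵fromℕ _ _ ((s , p) ∷ []) ((s₁ , p₁) ∷ []) ((s₂ , p₂) ∷ []) =
      ~-trans (truth-forced s (s₁ ∨ᵇ s₂) p (literal-∨ s₁ s₂ p₁ p₂)) (~-reflexive (F.truth-∨ s₁ s₂))
    substᵍ-∨ (‵inject₁ j) ma mb [] [] [] = ~-reflexive (ι-∨ j ma mb)

    substᵍ-¬ : ∀ {i} (w : View i) {a} (ma : member (A i) a) → ∀ P Q →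
               substᵍ w (¬-mem (A i) ma) P ~ ¬ₜ substᵍ w ma Q
    substᵍ-¬ ‵fromℕ _ ((s , p) ∷ []) ((s₁ , p₁) ∷ []) =
      ~-trans (truth-forced s (not s₁) p (literal-¬ s₁ p₁)) (~-reflexive (F.truth-not s₁))
    substᵍ-¬ (‵inject₁ j) ma [] [] = ~-reflexive (ι-¬ j ma)

    substᵍ-⊤ : ∀ {i} (w : View i) P → substᵍ w (⊤-mem (A i)) P ~ ⊤ₜ
    substᵍ-⊤ ‵fromℕ       ((s , p) ∷ []) = truth-forced s true p (⊤-literal α)
    substᵍ-⊤ (‵inject₁ j) []             = ~-reflexive (ι-⊤ j)

    substᵍ-⊥ : ∀ {i} (w : View i) P → substᵍ w (⊥-mem (A i)) P ~ ⊥ₜ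
    substᵍ-⊥ ‵fromℕ       ((s , p) ∷ []) = truth-forced s false p (⊥-literal α)
    substᵍ-⊥ (‵inject₁ j) []             = ~-reflexive (ι-⊥ j)

    substLast-cong : ∀ {t s} (e : _≈F_ B A t s) → All (Decides α) (lastGenerators≈ e) →
                     ∀ P Q → substLast t P ~ substLast s Q
    substLast-cong {t} reflF _ P Q = substLast-irrelevant t P Q
    substLast-cong (symF e) M P Q = ~-sym (substLast-cong e M Q P)
    substLast-cong (transF {s = s} e e′) M P Q =
      ~-trans (substLast-cong e (++⁻ˡ (lastGenerators≈ e) M′) P S) (substLast-cong e′ (++⁻ʳ (lastGenerators≈ e) M′) S Q)
      where
      S  = ++⁻ˡ (lastGenerators s) M
      M′ = ++⁻ʳ (lastGenerators s) M
    substLast-cong (∧-congF e e′) M P Q =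
      ~-∧ (substLast-cong e (++⁻ˡ (lastGenerators≈ e) M) _ _) (substLast-cong e′ (++⁻ʳ (lastGenerators≈ e) M) _ _)
    substLast-cong (∨-congF e e′) M P Q =
      ~-∨ (substLast-cong e (++⁻ˡ (lastGenerators≈ e) M) _ _) (substLast-cong e′ (++⁻ʳ (lastGenerators≈ e) M) _ _)
    substLast-cong (¬-congF e) M P Q = ~-¬ (substLast-cong e M P Q)
    substLast-cong (∧-commF t s) _ _ _ =
      ~-trans (~-∧ (substLast-irrelevant t _ _) (substLast-irrelevant s _ _)) (~-reflexive (∧-commF _ _))
    substLast-cong (∨-commF t s) _ _ _ =
      ~-trans (~-∨ (substLast-irrelevant t _ _) (substLast-irrelevant s _ _)) (~-reflexive (∨-commF _ _))
    substLast-cong (∧-assocF t s u) _ _ _ =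
      ~-trans (~-reflexive (∧-assocF _ _ _))
              (~-∧ (substLast-irrelevant t _ _) (~-∧ (substLast-irrelevant s _ _) (substLast-irrelevant u _ _)))
    substLast-cong (∨-assocF t s u) _ _ _ =
      ~-trans (~-reflexive (∨-assocF _ _ _))
              (~-∨ (substLast-irrelevant t _ _) (~-∨ (substLast-irrelevant s _ _) (substLast-irrelevant u _ _)))
    substLast-cong (∧-absF t s) _ _ _ =
      ~-trans (~-∧ (~-reflexive reflF) (~-∨ (substLast-irrelevant t _ _) (~-reflexive reflF)))
              (~-trans (~-reflexive (∧-absF _ _)) (substLast-irrelevant t _ _))
    substLast-cong (∨-absF t s) _ _ _ =
      ~-trans (~-∨ (~-reflexive reflF) (~-∧ (substLast-irrelevant t _ _) (~-reflexive reflF)))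
              (~-trans (~-reflexive (∨-absF _ _)) (substLast-irrelevant t _ _))
    substLast-cong (∧-distF t s u) _ _ _ =
      ~-trans (~-reflexive (∧-distF _ _ _))
              (~-∨ (~-∧ (substLast-irrelevant t _ _) (substLast-irrelevant s _ _))
                   (~-∧ (substLast-irrelevant t _ _) (substLast-irrelevant u _ _)))
    substLast-cong (∨-distF t s u) _ _ _ =
      ~-trans (~-reflexive (∨-distF _ _ _))
              (~-∧ (~-∨ (substLast-irrelevant t _ _) (substLast-irrelevant s _ _))
                   (~-∨ (substLast-irrelevant t _ _) (substLast-irrelevant u _ _)))
    substLast-cong (∧-complF t) _ _ _ =
      ~-trans (~-∧ (~-reflexive reflF) (~-¬ (substLast-irrelevant t _ _)))
              (~-reflexive (∧-complF _))
    substLast-cong (∨-complF t) _ _ _ =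
      ~-trans (~-∨ (~-reflexive reflF) (~-¬ (substLast-irrelevant t _ _)))
              (~-reflexive (∨-complF _))
    substLast-cong (ι-cong i ma mb a≈b) _ P Q = substᵍ-cong (view i) ma mb a≈b P Q
    substLast-cong (ι-∧ i ma mb)        _ P _ = substᵍ-∧ (view i) ma mb P _ _
    substLast-cong (ι-∨ i ma mb)        _ P _ = substᵍ-∨ (view i) ma mb P _ _
    substLast-cong (ι-¬ i ma)           _ P _ = substᵍ-¬ (view i) ma P _
    substLast-cong (ι-⊤ i)              _ P _ = substᵍ-⊤ (view i) P
    substLast-cong (ι-⊥ i)              _ P _ = substᵍ-⊥ (view i) P

  sharedLiteral : Gen B A∩ → Term B A<n
  sharedLiteral (j , z , mj , _) = gen (j , z , mj)

  sharedValue : Gen B A∩ → Carrier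
  sharedValue (_ , z , _) = z

  SharedDecides : Term B A<n → Carrier → Gen B A∩ → Set (c ⊔ ℓ ⊔ p)
  SharedDecides m γ g = Σ Bool λ s → m F.≤ F.literal (sharedLiteral g) s × γ ≤ literal (sharedValue g) s

  -- m and γ are the two images of an atom of the free product of the A∩ i: in that of the A<n i and in B.
  module IdealTransfer (α : Carrier) (m : Term B A<n) (γ : Carrier) where

    K : Term B A<n → Set (c ⊔ ℓ ⊔ p)
    K x = (γ ∧ α ≈ ⊥) ⊎ InIdeal B A<n (x ∧ₜ m)

    K-ideal : F.IsIdeal K
    K-ideal = F.const⊎-isIdeal _ (F.∧-preimage-isIdeal (InIdeal-isIdeal B A<n) m)

    escape : α ≈ ⊥ → ∀ x → K x
    escape α≈⊥ _ = inj₁ (trans (∧-congˡ α≈⊥) (∧-zeroʳ γ))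

    open Substitution α
    open Soundness α K-ideal escape
    open F.IsIdeal K-ideal
    private module I = F.IsIdeal (InIdeal-isIdeal B A<n)

    substLast-generator : ∀ {i j} (wi : View i) (wj : View j) {z} (mi : member (A i) z) (mj : member (A j) z) →
                          All (SharedDecides m γ) (sharedGeneratorsᵍ wi wj mi mj) → ∀ P Q →
                          K (substᵍ wi mi P ∧ₜ substᵍ wj (¬-mem (A j) mj) Q)
    substLast-generator (‵inject₁ i) (‵inject₁ j) mi mj [] [] [] = inj₂ (I.∧-closedʳ (gen-I i j mi mj))
    substLast-generator (‵inject₁ i) ‵fromℕ mi mj _ [] ((false , _) ∷ []) = ≈⊥-closed (FP.∧-zeroʳ _)
    substLast-generator (‵inject₁ i) ‵fromℕ mi mj ((true , _ , γ≤z) ∷ []) [] ((true , α≤¬z) ∷ []) =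
      inj₁ (literal-disjoint true γ≤z α≤¬z)
    substLast-generator (‵inject₁ i) ‵fromℕ mi mj ((false , m≤¬z , _) ∷ []) [] ((true , _) ∷ []) =
      inj₂ (I.≈⊥-closed (F.literal-disjoint true (F.x∧y≤x _ _) m≤¬z))
    substLast-generator ‵fromℕ (‵inject₁ j) mi mj _ ((false , _) ∷ []) [] = ≈⊥-closed (FP.∧-zeroˡ _)
    substLast-generator ‵fromℕ (‵inject₁ j) mi mj ((false , _ , γ≤¬z) ∷ []) ((true , α≤z) ∷ []) [] =
      inj₁ (literal-disjoint false γ≤¬z α≤z)
    substLast-generator ‵fromℕ (‵inject₁ j) mi mj ((true , m≤z , _) ∷ []) ((true , _) ∷ []) [] =
      inj₂ (I.≈⊥-closed (F.literal-disjoint false (F.≤-respʳ-≈ (ι-¬ j mj) (F.x∧y≤y _ _)) m≤z))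
    substLast-generator ‵fromℕ ‵fromℕ mi mj [] ((false , _) ∷ []) _ = ≈⊥-closed (FP.∧-zeroˡ _)
    substLast-generator ‵fromℕ ‵fromℕ mi mj [] ((true , _) ∷ []) ((false , _) ∷ []) = ≈⊥-closed (FP.∧-zeroʳ _)
    substLast-generator ‵fromℕ ‵fromℕ mi mj [] ((true , α≤z) ∷ []) ((true , α≤¬z) ∷ []) =
      escape (≤-contradiction α≤z α≤¬z) _

    substLast-InIdeal : ∀ {t} (d : InIdeal B A t) → All (Decides α) (lastGeneratorsᴵ d) →
                        All (SharedDecides m γ) (sharedGenerators d) → ∀ P → K (substLast t P)
    substLast-InIdeal (gen-I i j mi mj) _ S P = substLast-generator (view i) (view j) mi mj S _ _
    substLast-InIdeal ⊥-I _ _ _ = ⊥∈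
    substLast-InIdeal (∨-I d d′) M S P =
      ∨-closed (substLast-InIdeal d  (++⁻ˡ (lastGeneratorsᴵ d) M) (++⁻ˡ (sharedGenerators d) S) _)
               (substLast-InIdeal d′ (++⁻ʳ (lastGeneratorsᴵ d) M) (++⁻ʳ (sharedGenerators d) S) _)
    substLast-InIdeal (down-I {t} {s} e d) M S P = ~-closed (~-sym t∧s~t) (∧-closedˡ (~-closed s~s Ks))
      where
      Ps = ++⁻ˡ (lastGenerators s) M
      M′ = ++⁻ʳ (lastGenerators s) M
      Ks : K (substLast s Ps)
      Ks = substLast-InIdeal d (++⁻ʳ (lastGenerators≈ e) M′) S Ps
      s~s : substLast s (++⁻ʳ (lastGenerators t) (++⁺ P Ps)) ~ substLast s Ps
      s~s = substLast-irrelevant s _ _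
      t∧s~t : substLast (t ∧ₜ s) (++⁺ P Ps) ~ substLast t P
      t∧s~t = substLast-cong e (++⁻ˡ (lastGenerators≈ e) M′) (++⁺ P Ps) P

  private module F∩ = BooleanAlgebraLemmas (freeProduct B A∩)

  substLast-below-atoms :
    ∀ {u} (d : InIdeal B A (embed u)) (τ : All (λ _ → Bool) (sharedGenerators d))
    (σ : All (λ _ → Bool) (lastGenerators (embed u) ++ lastGeneratorsᴵ d)) →
    InIdeal B A<n (u ∧ₜ F.atom sharedLiteral τ) ⊎ (atom sharedValue τ ∧ atom id σ ≈ ⊥)
  substLast-below-atoms {u} d τ σ = swap (subst K (substLast-embed u P) (substLast-InIdeal d M S P))
    where
    α = atom id σ
    open Substitution α using (substLast-embed)
    open IdealTransfer α (F.atom sharedLiteral τ) (atom sharedValue τ)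
    decisions : All (Decides α) (lastGenerators (embed u) ++ lastGeneratorsᴵ d)
    decisions = tabulate λ q → lookup σ q , atom≤literal id σ q
    P = ++⁻ˡ (lastGenerators (embed u)) decisions
    M = ++⁻ʳ (lastGenerators (embed u)) decisions
    S = tabulate λ q → lookup τ q , F.atom≤literal sharedLiteral τ q , atom≤literal sharedValue τ q

  null-shared-atom : Commutes B A∩ → ∀ {gs} (τ : All (λ _ → Bool) gs) →
                     atom sharedValue τ ≈ ⊥ → InIdeal B A<n (F.atom sharedLiteral τ)
  null-shared-atom commutes-A∩ τ γ≈⊥ =
    subst (InIdeal B A<n) (atom-homomorphic restrict (λ _ _ → refl) (λ _ → refl) refl gen τ)
      (I.≈-closed (symF (F.x∧¬⊥∨¬x∧⊥≈x _)) (rename-InIdeal id proj₁ atom∩∈I))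
    where
    module I = F.IsIdeal (InIdeal-isIdeal B A<n)
    atom∩ = F∩.atom gen τ
    atom∩∈I : InIdeal B A∩ ((atom∩ ∧ₜ (¬ₜ ⊥ₜ)) ∨ₜ ((¬ₜ atom∩) ∧ₜ ⊥ₜ))
    atom∩∈I = commutes-A∩ atom∩ ⊥ₜ
                (subst (_≈ ⊥) (sym≡ (atom-homomorphic (eval B A∩) (λ _ _ → refl) (λ _ → refl) refl gen τ)) γ≈⊥)

lemma3p37 : ∀ {c ℓ p : Level} (B : BooleanAlgebra c ℓ) (n : ℕ)
              (A : Fin (suc n) → Subalgebra p B) →
              Commutes B A →
              Commutes B (λ i → A (inject₁ i) ∩ A (fromℕ n)) →
              Commutes B (λ i → A (inject₁ i))
lemma3p37 B n A commutes-A commutes-A∩ t s t≈s =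
  F.ideal-by-atoms I-ideal sharedLiteral (sharedGenerators d) λ τ →
    [ id , (λ γ≈⊥ → I.∧-closedˡ (null-shared-atom commutes-A∩ τ γ≈⊥)) ]′
      (ideal-by-atoms (const⊎-isIdeal _ ≈⊥-isIdeal) id _ (substLast-below-atoms d τ))
  where
  open LastCofactor B n A
  open BooleanAlgebraLemmas B using (ideal-by-atoms; const⊎-isIdeal; ≈⊥-isIdeal)
  module F = BooleanAlgebraLemmas (freeProduct B A<n)
  I-ideal = InIdeal-isIdeal B A<n
  module I = F.IsIdeal I-ideal
  d : InIdeal B A (embed ((t ∧ₜ (¬ₜ s)) ∨ₜ ((¬ₜ t) ∧ₜ s)))
  d = commutes-A (embed t) (embed s)
        (subst₂ (BooleanAlgebra._≈_ B) (sym≡ (eval-rename inject₁ _ t)) (sym≡ (eval-rename inject₁ _ s)) t≈s)
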